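{- Let $\mathcal{Q}:\varphi$ be an SSAT formula with $\varphi$ in conjunctive normal form containing only non-tautological clauses. If $Pr(\mathcal{Q}:\varphi) = p$, then the empty clause $\emptyset^p$ is derivable from $\mathcal{Q}:\varphi$ by S-resolution.
   Context: An SSAT formula is $\mathcal{Q} : \varphi$ where $\mathcal{Q} = Q_1x_1\ldots Q_nx_n$ is a prefix of quantified propositional variables, each $Q_i$ being either $\exists$ or a randomized quantifier $\mathsf{R}^{p_i}$ with rational $0<p_i<1$, and $\varphi$ is a propositional formula with $\mathrm{Var}(\varphi)\subseteq\{x_1,\dots,x_n\}$. Its maximum probability of satisfaction is defined recursively: $Pr(\varepsilon:\varphi)$ is $0$ if $\varphi$ is equivalent to false and $1$ if equivalent to true; $Pr(\exists x\,\mathcal{Q}':\varphi) = \max(Pr(\mathcal{Q}':\varphi[\mathrm{true}/x]),Pr(\mathcal{Q}':\varphi[\mathrm{false}/x]))$; $Pr(\mathsf{R}^p x\,\mathcal{Q}':\varphi) = p\,Pr(\mathcal{Q}':\varphi[\mathrm{true}/x]) + (1-p)\,Pr(\mathcal{Q}':\varphi[\mathrm{false}/x])$. A clause is a disjunction (identified with a set) of literals without repetitions; it is tautological if it is valid. For $\psi$ with variables among $x_1,\dots,x_n$, $\mathcal{Q}(\psi)$ is the shortest prefix $Q_1x_1\ldots Q_ix_i$ of $\mathcal{Q}$ containing all variables of $\psi$. For a non-tautological clause $c$, $\mathrm{ff}_c$ is the unique assignment on $\mathrm{Var}(c)$ falsifying $c$. S-resolution derives annotated clauses $c^p$ ($0\le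 p\le1$) by the rules: (R.1) for every clause $c$ of $\varphi$, derive $c^0$. (R.2) if $c$ is a non-tautological clause over literals of variables in $\mathrm{Var}(\varphi)$, $\mathcal{Q}(c) = Q_1x_1\ldots Q_ix_i$, and for every $\tau:\{x_1,\dots,x_i\}\to\{\mathrm{true},\mathrm{false}\}$ agreeing with $\mathrm{ff}_c$ on $\mathrm{Var}(c)$ the formula $\varphi[\tau(x_1)/x_1]\ldots[\tau(x_i)/x_i]$ is valid, derive $c^1$. (R.3) from derived $(c_1\vee\neg x)^{p_1}$ and $(c_2\vee x)^{p_2}$, where $Qx$ occurs in $\mathcal{Q}$ but not in $\mathcal{Q}(c_1\vee c_2)$ and $c_1\vee c_2$ is non-tautological, derive $(c_1\vee c_2)^p$ with $p=\max(p_1,p_2)$ if $Q=\exists$ and $p = p_x p_1 + (1-p_x)p_2$ if $Q = \mathsf{R}^{p_x}$. -}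

module Defs where

open import Data.Nat using (ℕ; zero; suc; _≤_)
open import Data.Fin using (Fin; toℕ)
open import Data.Bool using (Bool; true; false; not; if_then_else_; _∧_; _∨_)
open import Data.Maybe using (Maybe; just; nothing)
open import Data.Vec using (Vec; []; _∷_; lookup; zipWith; replicate; _[_]≔_)
open import Data.List using (List; []; _∷_)
open import Data.List.Membership.Propositional using (_∈_)
open import Data.Product using (∃; _×_)
open import Data.Empty using (⊥)
open import Data.Rational using (ℚ; 0ℚ; 1ℚ; _<_; _+_; _*_; _-_; _⊔_)
open import Relation.Binary.PropositionalEquality using (_≡_; _≢_)

data Quant : Set where
  exQ : Quant
  rnd : (p : ℚ) → 0ℚ < p → p < 1ℚ → Quant

-- A prefix Q₁x₁…Qₙxₙ over variables x₁..xₙ (indexed by Fin n, in order).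
Prefix : ℕ → Set
Prefix n = Vec Quant n

-- Non-tautological clauses over x₁..xₙ, as sets of literals:
-- entry i is  nothing  (x_i does not occur),  just true  (literal x_i),
-- or  just false  (literal ¬x_i).  This represents exactly the
-- non-tautological repetition-free clauses.

Clause : ℕ → Set
Clause n = Vec (Maybe Bool) n

emptyClause : ∀ {n} → Clause n
emptyClause = replicate _ nothing

CNF : ℕ → Set
CNF n = List (Clause n)

litSat : Maybe Bool → Bool → Bool
litSat nothing  _ = false
litSat (just b) v = if b then v else not v

clauseEval : ∀ {m} → Clause m → Vec Bool m → Bool
clauseEval []       []       = false
clauseEval (l ∷ c)  (v ∷ a)  = litSat l v ∨ clauseEval c a

cnfEval : ∀ {n} → CNF n → Vec Bool n → Bool
cnfEval []      a = true
cnfEval (c ∷ φ) a = clauseEval c a ∧ cnfEval φ a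

PrAux : ∀ {m} → Vec Quant m → (Vec Bool m → Bool) → ℚ
PrAux []              f = if f [] then 1ℚ else 0ℚ
PrAux (exQ ∷ Q)       f =
  PrAux Q (λ v → f (true ∷ v)) ⊔ PrAux Q (λ v → f (false ∷ v))
PrAux (rnd p _ _ ∷ Q) f =
  (p * PrAux Q (λ v → f (true ∷ v))) + ((1ℚ - p) * PrAux Q (λ v → f (false ∷ v)))

Pr : ∀ {n} → Prefix n → CNF n → ℚ
Pr Q φ = PrAux Q (cnfEval φ)

-- Length of 𝒬(c): the shortest prefix containing all variables of c
-- (1 + largest index of a variable of c, or 0 if c is empty).

isJust : Maybe Bool → Bool
isJust nothing  = false
isJust (just _) = true

prefixLen : ∀ {m} → Clause m → ℕ
prefixLen []      = 0
prefixLen (l ∷ c) with prefixLen c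
... | zero  = if isJust l then 1 else 0
... | suc k = suc (suc k)

VarOf : ∀ {n} → CNF n → Fin n → Set
VarOf φ i = ∃ λ c → c ∈ φ × lookup c i ≢ nothing

-- Set union of two clauses (only used when they are compatible,
-- i.e. the union is non-tautological).
merge : Maybe Bool → Maybe Bool → Maybe Bool
merge nothing  m = m
merge (just b) _ = just b

union : ∀ {n} → Clause n → Clause n → Clause n
union = zipWith merge

NonTaut∨ : ∀ {n} → Clause n → Clause n → Set
NonTaut∨ c₁ c₂ = ∀ j b → lookup c₁ j ≡ just b → lookup c₂ j ≡ just (not b) → ⊥

resolveProb : Quant → ℚ → ℚ → ℚ
resolveProb exQ            p₁ p₂ = p₁ ⊔ p₂
resolveProb (rnd px _ _)   p₁ p₂ = (px * p₁) + ((1ℚ - px) * p₂)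

data Derivable {n : ℕ} (Q : Prefix n) (φ : CNF n) : Clause n → ℚ → Set where
  r1 : ∀ {c} → c ∈ φ → Derivable Q φ c 0ℚ
  -- (R.2) c over Var(φ); for every τ on the variables of 𝒬(c) agreeing
  -- with ff_c, φ[τ] is valid (true under every extension of τ).
  r2 : ∀ {c} →
       (∀ i → lookup c i ≢ nothing → VarOf φ i) →
       (∀ (τ : Vec Bool n) →
          (∀ j b → lookup c j ≡ just b → lookup τ j ≡ not b) →
          ∀ (a : Vec Bool n) →
          (∀ j → Data.Nat._<_ (toℕ j) (prefixLen c) → lookup a j ≡ lookup τ j) →
          cnfEval φ a ≡ true) →
       Derivable Q φ c 1ℚ
  -- (R.3) resolution on pivot x_i, with x_i not in 𝒬(c₁ ∨ c₂)
  -- (i.e. prefixLen (c₁ ∨ c₂) ≤ i) and c₁ ∨ c₂ non-tautological.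
  r3 : ∀ {c₁ c₂ p₁ p₂} (i : Fin n) →
       Derivable Q φ (c₁ [ i ]≔ just false) p₁ →
       Derivable Q φ (c₂ [ i ]≔ just true) p₂ →
       prefixLen (union c₁ c₂) ≤ toℕ i →
       NonTaut∨ c₁ c₂ →
       Derivable Q φ (union c₁ c₂) (resolveProb (lookup Q i) p₁ p₂)

-- Write W_k(a) for the maximum satisfaction probability of 𝒬 : φ once x₁ … x_k are fixed as in a.
-- Soundness: every derivable c^q satisfies q = W_k(a) for k = |𝒬(c)| and every a extending ff_c,
-- because the three rules mirror the recursion defining W.
-- Completeness, by downward induction on k: every assignment a falsifies some derivable clause
-- whose variables lie among x₁ … x_k.  For k = n this is a clause of φ (R.1) if a falsifies φ,
-- and otherwise the clause negating a on Var(φ) (R.2).  Passing from k + 1 to k, the clauses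
-- found for a[x_{k+1} := true] and a[x_{k+1} := false] either avoid x_{k+1}, or contain ¬x_{k+1}
-- resp. x_{k+1} and resolve on it (R.3).  At k = 0 the clause is empty and soundness identifies
-- its annotation as W_0 = Pr(𝒬 : φ).
module Submission where

open import Defs
open import Function using (_∘_; case_of_)
open import Data.Nat using (ℕ; zero; suc; z≤n; s≤s; _≤_; _<_)
open import Data.Nat.Properties
  using (n≮0; ≤-pred; ≤-refl; ≤-trans; ≤-antisym; n≤0⇒n≡0; m<n⇒m<1+n; ≤∧≢⇒<)
open import Data.Fin using (Fin; toℕ; zero; suc; _≟_)
open import Data.Fin.Properties using (toℕ<n; toℕ-injective; toℕ-fromℕ; toℕ-inject₁)
open import Data.Fin.Induction using (>-weakInduction)
open import Data.Bool using (Bool; true; false; not; if_then_else_; _∧_; _∨_)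
open import Data.Bool.Properties using (not-involutive; not-¬; ∨-conicalˡ; ∨-conicalʳ; ∨-zeroʳ; ∧-zeroʳ)
open import Data.Maybe using (just; nothing)
open import Data.Maybe.Properties using (just-injective)
open import Data.Vec using (Vec; []; _∷_; lookup; replicate; tabulate; _[_]≔_)
open import Data.Vec.Properties
  using (lookup∘update; lookup∘update′; lookup-zipWith; []≔-idempotent; []≔-lookup; lookup∘tabulate)
open import Data.List using ([]; _∷_)
open import Data.List.Membership.Propositional using (_∈_)
open import Data.List.Relation.Unary.Any using (here; there)
open import Data.Product using (∃; _×_; _,_; proj₁; proj₂)
open import Data.Sum using (_⊎_; inj₁; inj₂; [_,_]′)
open import Data.Empty using (⊥-elim)
open import Data.Rational using (ℚ; 0ℚ; 1ℚ; _+_; _*_; _-_; -_)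
open import Data.Rational.Properties
  using (⊔-idem; *-distribʳ-+; *-identityˡ; +-comm; +-assoc; +-inverseʳ; +-identityˡ)
open import Relation.Binary.PropositionalEquality
open import Relation.Nullary using (yes; no)

resolveProb-idem : ∀ q r → resolveProb q r r ≡ r
resolveProb-idem exQ         r = ⊔-idem r
resolveProb-idem (rnd p _ _) r = begin
  p * r + (1ℚ - p) * r  ≡⟨ *-distribʳ-+ r p (1ℚ - p) ⟨
  (p + (1ℚ - p)) * r    ≡⟨ cong (_* r) p+[1-p]≡1 ⟩
  1ℚ * r                ≡⟨ *-identityˡ r ⟩
  r                     ∎
  where
  open ≡-Reasoning
  p+[1-p]≡1 : p + (1ℚ - p) ≡ 1ℚ
  p+[1-p]≡1 = begin
    p + (1ℚ + - p)  ≡⟨ cong (p +_) (+-comm 1ℚ (- p)) ⟩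
    p + (- p + 1ℚ)  ≡⟨ +-assoc p (- p) 1ℚ ⟨
    (p + - p) + 1ℚ  ≡⟨ cong (_+ 1ℚ) (+-inverseʳ p) ⟩
    0ℚ + 1ℚ         ≡⟨ +-identityˡ 1ℚ ⟩
    1ℚ              ∎

PrAux-∷ : ∀ {m} q (Q : Vec Quant m) f →
          PrAux (q ∷ Q) f ≡ resolveProb q (PrAux Q (f ∘ (true ∷_))) (PrAux Q (f ∘ (false ∷_)))
PrAux-∷ exQ         Q f = refl
PrAux-∷ (rnd _ _ _) Q f = refl

-- residualPr Q f k a is W_k(a); the entries of a beyond the first k are ignored.
residualPr : ∀ {m} → Vec Quant m → (Vec Bool m → Bool) → ℕ → Vec Bool m → ℚ
residualPr Q       f zero    a       = PrAux Q f
residualPr []      f (suc k) []      = PrAux [] f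
residualPr (_ ∷ Q) f (suc k) (b ∷ a) = residualPr Q (f ∘ (b ∷_)) k a

AgreeBelow : ∀ {m} → ℕ → Vec Bool m → Vec Bool m → Set
AgreeBelow k a a′ = ∀ j → toℕ j < k → lookup a j ≡ lookup a′ j

residualPr-top : ∀ {m} (Q : Vec Quant m) f a → residualPr Q f m a ≡ (if f a then 1ℚ else 0ℚ)
residualPr-top []      f []      = refl
residualPr-top (_ ∷ Q) f (b ∷ a) = residualPr-top Q (f ∘ (b ∷_)) a

PrAux-const : ∀ {m} (Q : Vec Quant m) f j {r} → (∀ a → residualPr Q f j a ≡ r) → PrAux Q f ≡ r
PrAux-const Q       f zero    h = h (replicate _ false)
PrAux-const []      f (suc j) h = h []
PrAux-const (q ∷ Q) f (suc j) {r} h = begin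
  PrAux (q ∷ Q) f    ≡⟨ PrAux-∷ q Q f ⟩
  resolveProb q _ _  ≡⟨ cong₂ (resolveProb q) (PrAux-const Q _ j (h ∘ (true ∷_)))
                                              (PrAux-const Q _ j (h ∘ (false ∷_))) ⟩
  resolveProb q r r  ≡⟨ resolveProb-idem q r ⟩
  r                  ∎
  where open ≡-Reasoning

residualPr-const : ∀ {m} (Q : Vec Quant m) f {k j} a {r} → k ≤ j →
                   (∀ a′ → AgreeBelow k a a′ → residualPr Q f j a′ ≡ r) → residualPr Q f k a ≡ r
residualPr-const Q       f {zero}  {j}     a       _ h = PrAux-const Q f j (λ a′ → h a′ (λ _ ()))
residualPr-const []      f {suc k} {suc j} []      _ h = h [] (λ ())
residualPr-const (q ∷ Q) f {suc k} {suc j} (b ∷ a) (s≤s k≤j) h =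
  residualPr-const Q _ a k≤j (λ a′ agree → h (b ∷ a′) λ where
    zero    _         → refl
    (suc i) (s≤s i<k) → agree i i<k)

residualPr-split : ∀ {m} (Q : Vec Quant m) f (i : Fin m) a →
                   residualPr Q f (toℕ i) a ≡
                   resolveProb (lookup Q i) (residualPr Q f (suc (toℕ i)) (a [ i ]≔ true))
                                            (residualPr Q f (suc (toℕ i)) (a [ i ]≔ false))
residualPr-split (q ∷ Q) f zero    (b ∷ a) = PrAux-∷ q Q f
residualPr-split (q ∷ Q) f (suc i) (b ∷ a) = residualPr-split Q _ i a

AllLits : ∀ {m} → (Fin m → Bool → Set) → Clause m → Set
AllLits P c = ∀ j b → lookup c j ≡ just b → P j b

VarsBelow : ∀ {m} → ℕ → Clause m → Set
VarsBelow k = AllLits (λ j _ → toℕ j < k)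

-- FalsifiedBy c a says that a extends ff_c.
FalsifiedBy : ∀ {m} → Clause m → Vec Bool m → Set
FalsifiedBy c a = AllLits (λ j b → lookup a j ≡ not b) c

_⊆_ : ∀ {m} → Clause m → Clause m → Set
c ⊆ c′ = AllLits (λ j b → lookup c′ j ≡ just b) c

allLits-⊆ : ∀ {m} {P : Fin m → Bool → Set} (c c′ : Clause m) →
            c ⊆ c′ → AllLits P c′ → AllLits P c
allLits-⊆ _ _ sub h j b = h j b ∘ sub j b

varsBelow-prefixLen : ∀ {m} (c : Clause m) → VarsBelow (prefixLen c) c
varsBelow-prefixLen (l ∷ c) j b e with prefixLen c | varsBelow-prefixLen c
varsBelow-prefixLen (l ∷ c) zero    b refl | zero  | _  = s≤s z≤n
varsBelow-prefixLen (l ∷ c) (suc j) b e    | zero  | ih = ⊥-elim (n≮0 (ih j b e))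
varsBelow-prefixLen (l ∷ c) zero    b e    | suc _ | _  = s≤s z≤n
varsBelow-prefixLen (l ∷ c) (suc j) b e    | suc _ | ih = s≤s (ih j b e)

varsBelow⇒prefixLen≤ : ∀ {m k} (c : Clause m) → VarsBelow k c → prefixLen c ≤ k
varsBelow⇒prefixLen≤ [] _ = z≤n
varsBelow⇒prefixLen≤ {k = zero} (l ∷ c) h
  with prefixLen c | varsBelow⇒prefixLen≤ {k = 0} c (λ j b e → ⊥-elim (n≮0 (h (suc j) b e)))
... | suc _ | ()
varsBelow⇒prefixLen≤ {k = zero} (nothing ∷ c) h | zero | _ = z≤n
varsBelow⇒prefixLen≤ {k = zero} (just b ∷ c)  h | zero | _ = ⊥-elim (n≮0 (h zero b refl))
varsBelow⇒prefixLen≤ {k = suc k} (l ∷ c) h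
  with prefixLen c | varsBelow⇒prefixLen≤ c (λ j b e → ≤-pred (h (suc j) b e))
varsBelow⇒prefixLen≤ {k = suc k} (nothing ∷ c) h | zero  | _  = z≤n
varsBelow⇒prefixLen≤ {k = suc k} (just _ ∷ c)  h | zero  | _  = s≤s z≤n
varsBelow⇒prefixLen≤ {k = suc k} (l ∷ c)       h | suc _ | le = s≤s le

prefixLen≤ : ∀ {m} (c : Clause m) → prefixLen c ≤ m
prefixLen≤ c = varsBelow⇒prefixLen≤ c (λ j _ _ → toℕ<n j)

varsBelow-zero : ∀ {m} (c : Clause m) → VarsBelow 0 c → c ≡ emptyClause
varsBelow-zero []            _ = refl
varsBelow-zero (nothing ∷ c) h =
  cong (nothing ∷_) (varsBelow-zero c (λ j b e → ⊥-elim (n≮0 (h (suc j) b e))))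
varsBelow-zero (just b ∷ c)  h = ⊥-elim (n≮0 (h zero b refl))

falsifiedBy-prefix : ∀ {m} (c : Clause m) a a′ → FalsifiedBy c a → AgreeBelow (prefixLen c) a a′ →
                     FalsifiedBy c a′
falsifiedBy-prefix c _ _ ff agree j b e = trans (sym (agree j (varsBelow-prefixLen c j b e))) (ff j b e)

falsifiedBy-nonTaut : ∀ {m} (c₁ c₂ : Clause m) a →
                      FalsifiedBy c₁ a → FalsifiedBy c₂ a → NonTaut∨ c₁ c₂
falsifiedBy-nonTaut _ _ _ ff₁ ff₂ j b e₁ e₂ = not-¬ (ff₁ j b e₁) (ff₂ j (not b) e₂)

union-literal : ∀ {m} (c₁ c₂ : Clause m) j {b} → lookup (union c₁ c₂) j ≡ just b →
                lookup c₁ j ≡ just b ⊎ lookup c₂ j ≡ just b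
union-literal c₁ c₂ j e rewrite lookup-zipWith merge j c₁ c₂ with lookup c₁ j
... | nothing = inj₂ e
... | just _  = inj₁ e

allLits-union : ∀ {m} {P : Fin m → Bool → Set} (c₁ c₂ : Clause m) →
                AllLits P c₁ → AllLits P c₂ → AllLits P (union c₁ c₂)
allLits-union c₁ c₂ h₁ h₂ j b e = [ h₁ j b , h₂ j b ]′ (union-literal c₁ c₂ j e)

⊆-unionˡ : ∀ {m} (c₁ c₂ : Clause m) → c₁ ⊆ union c₁ c₂
⊆-unionˡ c₁ c₂ j b e rewrite lookup-zipWith merge j c₁ c₂ | e = refl

⊆-unionʳ : ∀ {m} (c₁ c₂ : Clause m) → NonTaut∨ c₁ c₂ → c₂ ⊆ union c₁ c₂
⊆-unionʳ c₁ c₂ nt j b e rewrite lookup-zipWith merge j c₁ c₂ with lookup c₁ j in e₁ | b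
... | nothing    | _     = e
... | just true  | true  = refl
... | just false | false = refl
... | just true  | false = ⊥-elim (nt j true e₁ e)
... | just false | true  = ⊥-elim (nt j false e₁ e)

lookup⇒[]≔-id : ∀ {m} {A : Set} (xs : Vec A m) i {x} → lookup xs i ≡ x → xs [ i ]≔ x ≡ xs
lookup⇒[]≔-id xs i e = trans (cong (xs [ i ]≔_) (sym e)) ([]≔-lookup xs i)

[]≔-reinsert : ∀ {m} {A : Set} (xs : Vec A m) i {x y} →
               lookup xs i ≡ x → (xs [ i ]≔ y) [ i ]≔ x ≡ xs
[]≔-reinsert xs i e = trans ([]≔-idempotent xs i) (lookup⇒[]≔-id xs i e)

allLits-erase : ∀ {m} {P P′ : Fin m → Bool → Set} (c : Clause m) i →
                (∀ j b → j ≢ i → P j b → P′ j b) → AllLits P c → AllLits P′ (c [ i ]≔ nothing)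
allLits-erase c i weaken h j b e with j ≟ i
... | yes refl = case trans (sym (lookup∘update j c nothing)) e of λ ()
... | no j≢i   = weaken j b j≢i (h j b (trans (sym (lookup∘update′ j≢i c nothing)) e))

allLits-insert : ∀ {m} {P : Fin m → Bool → Set} (c : Clause m) i {b} →
                 AllLits P (c [ i ]≔ nothing) → P i b → AllLits P (c [ i ]≔ just b)
allLits-insert {P = P} c i {b} h Pib j b′ e with j ≟ i
... | yes refl = subst (P j) (just-injective (trans (sym (lookup∘update j c (just b))) e)) Pib
... | no j≢i   =
  h j b′ (trans (lookup∘update′ j≢i c nothing) (trans (sym (lookup∘update′ j≢i c (just b))) e))

falsifiedBy-erase : ∀ {m} (c : Clause m) a i v →
                    FalsifiedBy c a → FalsifiedBy (c [ i ]≔ nothing) (a [ i ]≔ v)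
falsifiedBy-erase c a i v = allLits-erase c i (λ j _ j≢i → trans (lookup∘update′ j≢i a v))

falsifiedBy-erase′ : ∀ {m} (c : Clause m) a i v →
                     FalsifiedBy c (a [ i ]≔ v) → FalsifiedBy (c [ i ]≔ nothing) a
falsifiedBy-erase′ c a i v = allLits-erase c i (λ j _ j≢i → trans (sym (lookup∘update′ j≢i a v)))

varsBelow-erase : ∀ {m} (c : Clause m) i →
                  VarsBelow (suc (toℕ i)) c → VarsBelow (toℕ i) (c [ i ]≔ nothing)
varsBelow-erase c i =
  allLits-erase c i (λ j _ j≢i j≤i → ≤∧≢⇒< (≤-pred j≤i) (j≢i ∘ toℕ-injective))

prefixLen-insert : ∀ {m} (c : Clause m) i {b} →
                   VarsBelow (toℕ i) c → prefixLen (c [ i ]≔ just b) ≡ suc (toℕ i)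
prefixLen-insert c i {b} below = ≤-antisym
  (varsBelow⇒prefixLen≤ (c [ i ]≔ just b)
     (allLits-insert c i (allLits-erase c i (λ _ _ _ → m<n⇒m<1+n) below) ≤-refl))
  (varsBelow-prefixLen (c [ i ]≔ just b) i b (lookup∘update i c (just b)))

pivot-literal : ∀ {m} (c : Clause m) a i b → FalsifiedBy c (a [ i ]≔ b) →
                lookup c i ≡ nothing ⊎ lookup c i ≡ just (not b)
pivot-literal c a i b ff with lookup c i in e
... | nothing = inj₁ refl
... | just b′ = inj₂ (cong just (sym (trans (cong not b≡¬b′) (not-involutive b′))))
  where
  b≡¬b′ : b ≡ not b′
  b≡¬b′ = trans (sym (lookup∘update i a b)) (ff i b′ e)

litSat-just-false : ∀ b v → litSat (just b) v ≡ false → v ≡ not b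
litSat-just-false true  false _ = refl
litSat-just-false false true  _ = refl

clauseEval-false : ∀ {m} (c : Clause m) a → FalsifiedBy c a → clauseEval c a ≡ false
clauseEval-false []      []      _  = refl
clauseEval-false (l ∷ c) (v ∷ a) ff =
  cong₂ _∨_ (litSat-false l (ff zero)) (clauseEval-false c a (ff ∘ suc))
  where
  litSat-false : ∀ l → (∀ b → l ≡ just b → v ≡ not b) → litSat l v ≡ false
  litSat-false nothing      _ = refl
  litSat-false (just true)  h rewrite h true refl  = refl
  litSat-false (just false) h rewrite h false refl = refl

clauseEval-false⁻ : ∀ {m} (c : Clause m) a → clauseEval c a ≡ false → FalsifiedBy c a
clauseEval-false⁻ (l ∷ c) (v ∷ a) e zero    b refl = litSat-just-false b v (∨-conicalˡ _ _ e)
clauseEval-false⁻ (l ∷ c) (v ∷ a) e (suc j)        = clauseEval-false⁻ c a (∨-conicalʳ _ _ e) j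

cnfEval-∈ : ∀ {m} {c : Clause m} φ a → c ∈ φ → clauseEval c a ≡ false → cnfEval φ a ≡ false
cnfEval-∈ (c ∷ φ) a (here refl)  e = cong (_∧ cnfEval φ a) e
cnfEval-∈ (c ∷ φ) a (there c∈φ) e =
  trans (cong (clauseEval c a ∧_) (cnfEval-∈ φ a c∈φ e)) (∧-zeroʳ _)

falsified-clause : ∀ {m} (φ : CNF m) a → cnfEval φ a ≡ false →
                   ∃ λ c → c ∈ φ × clauseEval c a ≡ false
falsified-clause (c ∷ φ) a e with clauseEval c a in eq
... | false = c , here refl , eq
... | true with c′ , c′∈φ , e′ ← falsified-clause φ a e = c′ , there c′∈φ , e′

occurs : ∀ {m} → CNF m → Fin m → Bool
occurs []      j = false
occurs (c ∷ φ) j = isJust (lookup c j) ∨ occurs φ j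

occurs⇒varOf : ∀ {m} (φ : CNF m) j → occurs φ j ≡ true → VarOf φ j
occurs⇒varOf (c ∷ φ) j e with lookup c j in eq
... | just _  = c , here refl , λ eq′ → case trans (sym eq′) eq of λ ()
... | nothing with c′ , c′∈φ , c′∋j ← occurs⇒varOf φ j e = c′ , there c′∈φ , c′∋j

clauseEval-cong : ∀ {m} (c : Clause m) a a′ →
                  (∀ j → isJust (lookup c j) ≡ true → lookup a j ≡ lookup a′ j) →
                  clauseEval c a ≡ clauseEval c a′
clauseEval-cong []      []      []        _ = refl
clauseEval-cong (l ∷ c) (v ∷ a) (v′ ∷ a′) h =
  cong₂ _∨_ (litSat-cong l (h zero)) (clauseEval-cong c a a′ (h ∘ suc))
  where
  litSat-cong : ∀ l → (isJust l ≡ true → v ≡ v′) → litSat l v ≡ litSat l v′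
  litSat-cong nothing  _ = refl
  litSat-cong (just _) h rewrite h refl = refl

cnfEval-cong : ∀ {m} (φ : CNF m) a a′ → (∀ j → occurs φ j ≡ true → lookup a j ≡ lookup a′ j) →
               cnfEval φ a ≡ cnfEval φ a′
cnfEval-cong []      a a′ _ = refl
cnfEval-cong (c ∷ φ) a a′ h = cong₂ _∧_
  (clauseEval-cong c a a′ (λ j e → h j (cong (_∨ occurs φ j) e)))
  (cnfEval-cong φ a a′ (λ j e → h j (trans (cong (isJust (lookup c j) ∨_) e) (∨-zeroʳ _))))

negationOn : ∀ {m} → (Fin m → Bool) → Vec Bool m → Clause m
negationOn S a = tabulate λ j → if S j then just (not (lookup a j)) else nothing

lookup-negationOn : ∀ {m} S (a : Vec Bool m) j →
                    lookup (negationOn S a) j ≡ (if S j then just (not (lookup a j)) else nothing)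
lookup-negationOn S a j = lookup∘tabulate (λ k → if S k then just (not (lookup a k)) else nothing) j

negationOn-literal : ∀ {m} S (a : Vec Bool m) j {b} → lookup (negationOn S a) j ≡ just b →
                     S j ≡ true × lookup a j ≡ not b
negationOn-literal S a j e rewrite lookup-negationOn S a j with S j
negationOn-literal S a j refl | true = refl , sym (not-involutive (lookup a j))

falsifiedBy-negationOn : ∀ {m} S (a a′ : Vec Bool m) → FalsifiedBy (negationOn S a) a′ →
                         ∀ j → S j ≡ true → lookup a′ j ≡ lookup a j
falsifiedBy-negationOn S a a′ ff j Sj = trans (ff j _ literal) (not-involutive (lookup a j))
  where
  literal : lookup (negationOn S a) j ≡ just (not (lookup a j))
  literal = trans (lookup-negationOn S a j) (cong (λ s → if s then just (not (lookup a j)) else nothing) Sj)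

module _ {n} (Q : Prefix n) (φ : CNF n) where

  W : ℕ → Vec Bool n → ℚ
  W = residualPr Q (cnfEval φ)

  resolvent-premise : ∀ {p} c i b a → VarsBelow (toℕ i) c → FalsifiedBy c a →
                      (∀ a → FalsifiedBy (c [ i ]≔ just (not b)) a →
                             W (prefixLen (c [ i ]≔ just (not b))) a ≡ p) →
                      W (suc (toℕ i)) (a [ i ]≔ b) ≡ p
  resolvent-premise {p} c i b a below ff sound-premise =
    subst (λ k → W k (a [ i ]≔ b) ≡ p) (prefixLen-insert c i below)
      (sound-premise (a [ i ]≔ b) (allLits-insert c i (falsifiedBy-erase c a i b ff) pivot-false))
    where
    pivot-false : lookup (a [ i ]≔ b) i ≡ not (not b)
    pivot-false = trans (lookup∘update i a b) (sym (not-involutive b))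

  sound : ∀ {c q} → Derivable Q φ c q → ∀ a → FalsifiedBy c a → W (prefixLen c) a ≡ q
  sound {c} (r1 c∈φ) a ff = residualPr-const Q _ a (prefixLen≤ c) λ a′ agree →
    trans (residualPr-top Q _ a′)
          (cong (λ x → if x then 1ℚ else 0ℚ)
                (cnfEval-∈ φ a′ c∈φ (clauseEval-false c a′ (falsifiedBy-prefix c a a′ ff agree))))
  sound {c} (r2 _ valid) a ff = residualPr-const Q _ a (prefixLen≤ c) λ a′ agree →
    trans (residualPr-top Q _ a′)
          (cong (λ x → if x then 1ℚ else 0ℚ) (valid a ff a′ (λ j j<k → sym (agree j j<k))))
  sound (r3 {c₁} {c₂} i d₁ d₂ le nt) a ff = residualPr-const Q _ a le λ a′ agree →
    let ff′ = falsifiedBy-prefix (union c₁ c₂) a a′ ff agree in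
    trans (residualPr-split Q _ i a′)
          (cong₂ (resolveProb (lookup Q i))
            (resolvent-premise c₁ i true a′ (allLits-⊆ c₁ c (⊆-unionˡ c₁ c₂) below)
               (allLits-⊆ c₁ c (⊆-unionˡ c₁ c₂) ff′) (sound d₁))
            (resolvent-premise c₂ i false a′ (allLits-⊆ c₂ c (⊆-unionʳ c₁ c₂ nt) below)
               (allLits-⊆ c₂ c (⊆-unionʳ c₁ c₂ nt) ff′) (sound d₂)))
    where
    c : Clause n
    c = union c₁ c₂
    below : VarsBelow (toℕ i) c
    below j b e = ≤-trans (varsBelow-prefixLen c j b e) le

  record Certificate (k : ℕ) (a : Vec Bool n) : Set where
    constructor certificate
    field
      clause     : Clause n
      prob       : ℚ
      below      : VarsBelow k clause
      falsified  : FalsifiedBy clause a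
      derivation : Derivable Q φ clause prob
  open Certificate

  certificate-top : ∀ a → Certificate n a
  certificate-top a with cnfEval φ a in eq
  ... | false with c , c∈φ , e ← falsified-clause φ a eq =
    certificate c 0ℚ (λ j _ _ → toℕ<n j) (clauseEval-false⁻ c a e) (r1 c∈φ)
  ... | true = certificate c 1ℚ (λ j _ _ → toℕ<n j)
                 (λ j b → proj₂ ∘ negationOn-literal (occurs φ) a j) (r2 over-varφ valid)
    where
    c : Clause n
    c = negationOn (occurs φ) a
    over-varφ : ∀ j → lookup c j ≢ nothing → VarOf φ j
    over-varφ j j∈c with lookup c j in e
    ... | nothing = ⊥-elim (j∈c refl)
    ... | just _  = occurs⇒varOf φ j (proj₁ (negationOn-literal (occurs φ) a j e))
    valid : ∀ τ → FalsifiedBy c τ → ∀ a′ → (∀ j → toℕ j < prefixLen c → lookup a′ j ≡ lookup τ j) →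
            cnfEval φ a′ ≡ true
    valid τ ff a′ agree = trans (cnfEval-cong φ a′ a (falsifiedBy-negationOn (occurs φ) a a′ ff′)) eq
      where
      ff′ : FalsifiedBy c a′
      ff′ = falsifiedBy-prefix c τ a′ ff (λ j j<k → sym (agree j j<k))

  drop-pivot : ∀ i {a b} (C : Certificate (suc (toℕ i)) (a [ i ]≔ b)) →
               lookup (clause C) i ≡ nothing → Certificate (toℕ i) a
  drop-pivot i {a} {b} (certificate c p below ff d) x∉c = certificate c p
    (subst (VarsBelow (toℕ i)) c[i]≔nothing≡c (varsBelow-erase c i below))
    (subst (λ c → FalsifiedBy c a) c[i]≔nothing≡c (falsifiedBy-erase′ c a i b ff))
    d
    where
    c[i]≔nothing≡c : c [ i ]≔ nothing ≡ c
    c[i]≔nothing≡c = lookup⇒[]≔-id c i x∉c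

  resolve-pivot : ∀ i {a} (C₁ : Certificate (suc (toℕ i)) (a [ i ]≔ true))
                  (C₂ : Certificate (suc (toℕ i)) (a [ i ]≔ false)) →
                  lookup (clause C₁) i ≡ just false → lookup (clause C₂) i ≡ just true →
                  Certificate (toℕ i) a
  resolve-pivot i {a} (certificate c₁ p₁ below₁ ff₁ d₁) (certificate c₂ p₂ below₂ ff₂ d₂)
                ¬x∈c₁ x∈c₂ =
    certificate (union c₁′ c₂′) _ below′ (allLits-union c₁′ c₂′ ff₁′ ff₂′)
      (r3 i (subst (λ c → Derivable Q φ c p₁) (sym ([]≔-reinsert c₁ i ¬x∈c₁)) d₁)
            (subst (λ c → Derivable Q φ c p₂) (sym ([]≔-reinsert c₂ i x∈c₂)) d₂)
            (varsBelow⇒prefixLen≤ (union c₁′ c₂′) below′)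
            (falsifiedBy-nonTaut c₁′ c₂′ a ff₁′ ff₂′))
    where
    c₁′ c₂′ : Clause n
    c₁′ = c₁ [ i ]≔ nothing
    c₂′ = c₂ [ i ]≔ nothing
    ff₁′ : FalsifiedBy c₁′ a
    ff₁′ = falsifiedBy-erase′ c₁ a i true ff₁
    ff₂′ : FalsifiedBy c₂′ a
    ff₂′ = falsifiedBy-erase′ c₂ a i false ff₂
    below′ : VarsBelow (toℕ i) (union c₁′ c₂′)
    below′ = allLits-union c₁′ c₂′ (varsBelow-erase c₁ i below₁) (varsBelow-erase c₂ i below₂)

  certificate-step : ∀ i {a} → Certificate (suc (toℕ i)) (a [ i ]≔ true) →
                     Certificate (suc (toℕ i)) (a [ i ]≔ false) → Certificate (toℕ i) a
  certificate-step i {a} C₁ C₂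
    with pivot-literal (clause C₁) a i true (falsified C₁)
       | pivot-literal (clause C₂) a i false (falsified C₂)
  ... | inj₁ x∉c₁  | _         = drop-pivot i C₁ x∉c₁
  ... | inj₂ _     | inj₁ x∉c₂ = drop-pivot i C₂ x∉c₂
  ... | inj₂ ¬x∈c₁ | inj₂ x∈c₂ = resolve-pivot i C₁ C₂ ¬x∈c₁ x∈c₂

  certificates : ∀ k a → Certificate (toℕ k) a
  certificates = >-weakInduction (λ k → ∀ a → Certificate (toℕ k) a)
    (subst (λ k → ∀ a → Certificate k a) (sym (toℕ-fromℕ n)) certificate-top)
    (λ i C a → subst (λ k → Certificate k a) (sym (toℕ-inject₁ i)) (certificate-step i (C _) (C _)))

  emptyClause-derivable : Derivable Q φ emptyClause (Pr Q φ)
  emptyClause-derivable with certificates zero (replicate n false)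
  ... | certificate c p below ff d = subst₂ (Derivable Q φ) (varsBelow-zero c below) p≡Pr d
    where
    open ≡-Reasoning
    p≡Pr : p ≡ Pr Q φ
    p≡Pr = begin
      p                                    ≡⟨ sound d (replicate n false) ff ⟨
      W (prefixLen c) (replicate n false)  ≡⟨ cong (λ k → W k (replicate n false))
                                                   (n≤0⇒n≡0 (varsBelow⇒prefixLen≤ c below)) ⟩
      W 0 (replicate n false)              ∎

theorem3p3 : (n : ℕ) (Q : Prefix n) (φ : CNF n) (p : ℚ) →
             Pr Q φ ≡ p → Derivable Q φ emptyClause p
theorem3p3 n Q φ _ refl = emptyClause-derivable Q φ
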